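{- Let $f_0:\{1,2,\dots\}\to\mathbb{C}$ be an arithmetic function, with iterated invert transforms $f_m$ and numbers $c_m(n,k)$ as in the context. For every integer $m\ge1$ and $n\ge1$, $C_m(n)=C_1(n)\,L_n^{m-1}$; explicitly, for $1\le k\le n$, \[ c_m(n,k)=\sum_{i=k}^{n}(m-1)^{i-k}\binom{i-1}{k-1}c_1(n,i) \] (with the convention $0^0=1$).
   Context: For $m\ge1$, $f_m$ is the $m$th invert transform of $f_0$, defined recursively by $f_m(0)=1$ and $f_m(n)=\sum_{i=1}^{n} f_{m-1}(i)\,f_m(n-i)$ for $n\ge1$; equivalently, $1+\sum_{n\ge1}f_m(n)x^n=\bigl(1-\sum_{n\ge1}f_{m-1}(n)x^n\bigr)^{ -1}$. For integers $m\ge1$ and $0\le k\le n$, $c_m(n,k)$ is defined by $c_m(0,0)=1$, $c_m(n,0)=0$ for $n\ge1$, and $c_m(n,k)=\sum_{i=1}^{n-k+1} f_{m-1}(i)\,c_m(n-i,k-1)$ for $1\le k\le n$. $C_m(n)$ denotes the $n\times n$ lower triangular matrix whose $(r,s)$ entry is $c_m(r,s)$ for $1\le s\le r\le n$, and $L_n$ is the $n\times n$ lower triangular Pascal matrix with $(r,s)$ entry $\binom{r-1}{s-1}$. -}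

module Defs where

open import Data.Nat using (ℕ; zero; suc; _∸_; _^_)
import Data.Nat
open import Data.Nat.Combinatorics using (_C_)
open import Data.Vec using (Vec; []; _∷_; head)
open import Algebra.Bundles using (CommutativeRing; Semiring)
import Algebra.Definitions.RawSemiring as RS

module _ {c ℓ} (R : CommutativeRing c ℓ) where
  open CommutativeRing R
  open RS (Semiring.rawSemiring semiring) using (_×_)

  sumFrom : ℕ → ℕ → (ℕ → Carrier) → Carrier
  sumFrom lo zero    h = 0#
  sumFrom lo (suc l) h = h lo + sumFrom (suc lo) l h

  -- Σ_{i=a}^{b} h i  (empty, i.e. 0, when b < a)
  sumRange : ℕ → ℕ → (ℕ → Carrier) → Carrier
  sumRange a b h = sumFrom a (suc b ∸ a) h

  conv : (ℕ → Carrier) → ℕ → ∀ {n} → Vec Carrier n → Carrier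
  conv g i []       = 0#
  conv g i (x ∷ xs) = g i * x + conv g (suc i) xs

  -- table g n = [ inv g n , inv g (n-1) , … , inv g 0 ]
  -- where inv g 0 = 1 and inv g n = Σ_{i=1}^{n} g i * inv g (n - i)
  table : (ℕ → Carrier) → (n : ℕ) → Vec Carrier (suc n)
  table g zero    = 1# ∷ []
  table g (suc n) = conv g 1 (table g n) ∷ table g n

  -- invert transform of g (the value g 0 is never used)
  invert : (ℕ → Carrier) → ℕ → Carrier
  invert g n = head (table g n)

  f : (ℕ → Carrier) → ℕ → ℕ → Carrier
  f f₀ zero    = f₀
  f f₀ (suc m) = invert (f f₀ m)

  cc : (ℕ → Carrier) → ℕ → ℕ → Carrier
  cc g zero    zero    = 1#
  cc g (suc n) zero    = 0#
  cc g n       (suc k) = sumRange 1 (n ∸ k) (λ i → g i * cc g (n ∸ i) k)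

  -- c_m(n,k)  (meaningful for m ≥ 1)
  cm : (ℕ → Carrier) → ℕ → ℕ → ℕ → Carrier
  cm f₀ m n k = cc (f f₀ (m ∸ 1)) n k

  rhs : (ℕ → Carrier) → ℕ → ℕ → ℕ → Carrier
  rhs f₀ m n k =
    sumRange k n (λ i → (((m ∸ 1) ^ (i ∸ k)) Data.Nat.* ((i ∸ 1) C (k ∸ 1))) × cm f₀ 1 n i)

-- Let F = Σ_{n ≥ 1} f₀(n) xⁿ. Then c₁(n, i) = [xⁿ] Fⁱ, so Σ_i p_i c₁(n, i) = [xⁿ] p(F), and since F
-- has no constant term, p ↦ p(F) is a homomorphism of formal power series. The invert transform maps
-- the generating function H of a sequence to Y - 1 where Y = 1 + H Y, i.e. Y = (1 - H)⁻¹; as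
-- (1 - x/(1 - r x))⁻¹ = 1 + x/(1 - (r + 1) x), induction on m shows that f_m has generating function
-- G_m(F) with G_m = x/(1 - m x). Hence c_{m+1}(n, k) = [xⁿ] G_m(F)ᵏ = Σ_i [xⁱ] G_mᵏ · c₁(n, i), and
-- [xⁱ] (x/(1 - m x))ᵏ = m^{i-k} binom(i-1, k-1) by Pascal's rule.

module Submission where

open import Algebra.Bundles using (CommutativeMonoid; Semiring; CommutativeSemiring; CommutativeRing)
import Algebra.Definitions.RawSemiring as RawSemiringDefinitions
import Algebra.Properties.Semiring.Exp as SemiringExp
import Algebra.Properties.Semiring.Mult as SemiringMult
import Algebra.Structures.Biased as Biased
open import Data.Nat.Base as ℕ using (ℕ; zero; suc; _∸_; _≤_; _<_; z≤n; s≤s; z<s)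
open import Data.Nat.Combinatorics using (_C_; k>n⇒nCk≡0; nCk+nC[k+1]≡[n+1]C[k+1])
open import Data.Nat.Induction using (<-rec)
import Data.Nat.Properties as ℕₚ
open import Data.Sum.Base using (inj₁; inj₂)
open import Relation.Binary.PropositionalEquality as ≡ using (_≡_; module ≡-Reasoning)
import Relation.Binary.Reasoning.Setoid as SetoidReasoning
open import Relation.Nullary.Negation using (contradiction)
import Algebra.Construct.Pointwise ℕ as Pointwise

open import Defs

module _ where
  open import Data.Nat.Base using (_+_; _*_; _^_)
  open ℕₚ

  n∸k≤j⇒n∸[1+j]<k : ∀ n k j → n ∸ k ≤ j → j < n → n ∸ suc j < k
  n∸k≤j⇒n∸[1+j]<k n zero    j n≤j   j<n = contradiction j<n (≤⇒≯ n≤j)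
  n∸k≤j⇒n∸[1+j]<k n (suc k) j n∸k≤j _   = m<n+o⇒m∸n<o n (suc j) (s≤s (begin
    n                   ≤⟨ m≤n+m∸n n (suc k) ⟩
    suc k + (n ∸ suc k) ≤⟨ +-monoʳ-≤ (suc k) n∸k≤j ⟩
    suc k + j           ≡⟨ +-comm (suc k) j ⟩
    j + suc k           ∎))
    where open ≤-Reasoning

  -- [xⁱ] (x / (1 - r x))ᵏ
  geometricPowerCoeff : ℕ → ℕ → ℕ → ℕ
  geometricPowerCoeff r zero    zero    = 1
  geometricPowerCoeff r zero    (suc i) = 0
  geometricPowerCoeff r (suc k) zero    = 0
  geometricPowerCoeff r (suc k) (suc i) = r ^ (i ∸ k) * (i C k)

  geometricPowerCoeff-pascal : ∀ r k i →
    geometricPowerCoeff r (suc k) (suc i) ≡ geometricPowerCoeff r k i + r * geometricPowerCoeff r (suc k) i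
  geometricPowerCoeff-pascal r zero    zero    = ≡.cong (1 +_) (≡.sym (*-zeroʳ r))
  geometricPowerCoeff-pascal r zero    (suc i) = *-assoc r (r ^ i) 1
  geometricPowerCoeff-pascal r (suc k) zero    = ≡.sym (*-zeroʳ r)
  geometricPowerCoeff-pascal r (suc k) (suc i) = begin
    r ^ (i ∸ k) * (suc i C suc k)                               ≡⟨ ≡.cong (r ^ (i ∸ k) *_) (nCk+nC[k+1]≡[n+1]C[k+1] i k) ⟨
    r ^ (i ∸ k) * (i C k + i C suc k)                           ≡⟨ *-distribˡ-+ (r ^ (i ∸ k)) (i C k) (i C suc k) ⟩
    r ^ (i ∸ k) * (i C k) + r ^ (i ∸ k) * (i C suc k)           ≡⟨ ≡.cong (r ^ (i ∸ k) * (i C k) +_) shifted ⟩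
    r ^ (i ∸ k) * (i C k) + r * (r ^ (i ∸ suc k) * (i C suc k)) ∎
    where
    open ≡-Reasoning
    shifted : r ^ (i ∸ k) * (i C suc k) ≡ r * (r ^ (i ∸ suc k) * (i C suc k))
    shifted with ≤-<-connex (suc k) i
    ... | inj₁ k<i rewrite +-∸-assoc 1 k<i = *-assoc r (r ^ (i ∸ suc k)) (i C suc k)
    ... | inj₂ i≤k rewrite k>n⇒nCk≡0 i≤k | *-zeroʳ (r ^ (i ∸ k)) | *-zeroʳ (r ^ (i ∸ suc k)) =
      ≡.sym (*-zeroʳ r)

module FiniteSums {a ℓ} (M : CommutativeMonoid a ℓ) where
  open CommutativeMonoid M
  open import Data.Nat.Base using (_+_)
  open import Algebra.Properties.CommutativeSemigroup commutativeSemigroup using (interchange)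
  open SetoidReasoning setoid

  -- Opaque so that unification never unfolds sum< (suc n) h, which would hide h; the recursion
  -- is available through sum<-empty and sum<-suc.
  opaque
    sum< : ℕ → (ℕ → Carrier) → Carrier
    sum< zero    h = ε
    sum< (suc n) h = h 0 ∙ sum< n (λ i → h (suc i))

    sum<-empty : ∀ h → sum< 0 h ≈ ε
    sum<-empty h = refl

    sum<-suc : ∀ n h → sum< (suc n) h ≈ h 0 ∙ sum< n (λ i → h (suc i))
    sum<-suc n h = refl

    sum<-cong< : ∀ n {h g} → (∀ i → i < n → h i ≈ g i) → sum< n h ≈ sum< n g
    sum<-cong< zero    h≈g = refl
    sum<-cong< (suc n) h≈g = ∙-cong (h≈g 0 z<s) (sum<-cong< n (λ i i<n → h≈g (suc i) (s≤s i<n)))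

    sum<-cong : ∀ n {h g} → (∀ i → h i ≈ g i) → sum< n h ≈ sum< n g
    sum<-cong n h≈g = sum<-cong< n (λ i _ → h≈g i)

    sum<-zero : ∀ n {h} → (∀ i → i < n → h i ≈ ε) → sum< n h ≈ ε
    sum<-zero zero    h≈ε = refl
    sum<-zero (suc n) h≈ε = trans (∙-cong (h≈ε 0 z<s) (sum<-zero n (λ i i<n → h≈ε (suc i) (s≤s i<n)))) (identityˡ ε)

    sum<-distrib : ∀ n h g → sum< n (λ i → h i ∙ g i) ≈ sum< n h ∙ sum< n g
    sum<-distrib zero    h g = sym (identityˡ ε)
    sum<-distrib (suc n) h g = trans (∙-congˡ (sum<-distrib n _ _)) (interchange _ _ _ _)

    sum<-comm : ∀ m n (h : ℕ → ℕ → Carrier) → sum< m (λ i → sum< n (h i)) ≈ sum< n (λ j → sum< m (λ i → h i j))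
    sum<-comm zero    n h = sym (sum<-zero n (λ _ _ → refl))
    sum<-comm (suc m) n h = trans (∙-congˡ (sum<-comm m n _)) (sym (sum<-distrib n _ _))

    sum<-split : ∀ m n h → sum< (m + n) h ≈ sum< m h ∙ sum< n (λ j → h (m + j))
    sum<-split zero    n h = sym (identityˡ _)
    sum<-split (suc m) n h = trans (∙-congˡ (sum<-split m n (λ i → h (suc i)))) (sym (assoc _ _ _))

    sum<-last : ∀ n h → sum< (suc n) h ≈ sum< n h ∙ h n
    sum<-last n h = begin
      sum< (suc n) h             ≡⟨ ≡.cong (λ l → sum< l h) (ℕₚ.+-comm 1 n) ⟩
      sum< (n + 1) h             ≈⟨ sum<-split n 1 h ⟩
      sum< n h ∙ (h (n + 0) ∙ ε) ≈⟨ ∙-congˡ (identityʳ _) ⟩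
      sum< n h ∙ h (n + 0)       ≡⟨ ≡.cong (λ i → sum< n h ∙ h i) (ℕₚ.+-identityʳ n) ⟩
      sum< n h ∙ h n             ∎

    sum<-extend : ∀ l L h → l ≤ L → (∀ j → l ≤ j → j < L → h j ≈ ε) → sum< l h ≈ sum< L h
    sum<-extend zero    L       h _         h≈ε = sym (sum<-zero L (λ j j<L → h≈ε j z≤n j<L))
    sum<-extend (suc l) (suc L) h (s≤s l≤L) h≈ε =
      ∙-congˡ (sum<-extend l L (λ i → h (suc i)) l≤L (λ j l≤j j<L → h≈ε (suc j) (s≤s l≤j) (s≤s j<L)))

    sum<-dropPrefix : ∀ m N h → m ≤ N → (∀ i → i < m → h i ≈ ε) → sum< N h ≈ sum< (N ∸ m) (λ j → h (m + j))
    sum<-dropPrefix m N h m≤N h≈ε = begin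
      sum< N h                                  ≡⟨ ≡.cong (λ l → sum< l h) (ℕₚ.m+[n∸m]≡n m≤N) ⟨
      sum< (m + (N ∸ m)) h                      ≈⟨ sum<-split m (N ∸ m) h ⟩
      sum< m h ∙ sum< (N ∸ m) (λ j → h (m + j)) ≈⟨ ∙-congʳ (sum<-zero m h≈ε) ⟩
      ε ∙ sum< (N ∸ m) (λ j → h (m + j))        ≈⟨ identityˡ _ ⟩
      sum< (N ∸ m) (λ j → h (m + j))            ∎

    sum<-reverse : ∀ n h → sum< n h ≈ sum< n (λ i → h (n ∸ suc i))
    sum<-reverse zero    h = refl
    sum<-reverse (suc n) h = begin
      sum< (suc n) h                       ≈⟨ sum<-last n h ⟩
      sum< n h ∙ h n                       ≈⟨ comm _ _ ⟩
      h n ∙ sum< n h                       ≈⟨ ∙-congˡ (sum<-reverse n h) ⟩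
      h n ∙ sum< n (λ i → h (n ∸ suc i))   ∎

    sum<-triangle : ∀ n (h : ℕ → ℕ → Carrier) →
      sum< (suc n) (λ s → sum< (suc s) (λ a → h a (s ∸ a))) ≈ sum< (suc n) (λ a → sum< (suc (n ∸ a)) (h a))
    sum<-triangle zero    h = refl
    sum<-triangle (suc n) h = begin
      (h 0 0 ∙ ε) ∙ sum< (suc n) (λ s → h 0 (suc s) ∙ inner s)
        ≈⟨ ∙-congˡ (sum<-distrib (suc n) (λ s → h 0 (suc s)) inner) ⟩
      (h 0 0 ∙ ε) ∙ (sum< (suc n) (λ s → h 0 (suc s)) ∙ sum< (suc n) inner)
        ≈⟨ ∙-congˡ (∙-congˡ (sum<-triangle n (λ a → h (suc a)))) ⟩
      (h 0 0 ∙ ε) ∙ (sum< (suc n) (λ s → h 0 (suc s)) ∙ rest)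
        ≈⟨ ∙-congʳ (identityʳ _) ⟩
      h 0 0 ∙ (sum< (suc n) (λ s → h 0 (suc s)) ∙ rest)
        ≈⟨ assoc _ _ _ ⟨
      (h 0 0 ∙ sum< (suc n) (λ s → h 0 (suc s))) ∙ rest
        ∎
      where
      inner : ℕ → Carrier
      inner s = sum< (suc s) (λ a → h (suc a) (s ∸ a))
      rest : Carrier
      rest = sum< (suc n) (λ a → sum< (suc (n ∸ a)) (h (suc a)))

module SemiringSums {c ℓ} (R : Semiring c ℓ) where
  open Semiring R
  open FiniteSums +-commutativeMonoid public

  opaque
    unfolding sum<

    *-distribˡ-sum< : ∀ n x h → x * sum< n h ≈ sum< n (λ i → x * h i)
    *-distribˡ-sum< zero    x h = zeroʳ x
    *-distribˡ-sum< (suc n) x h = trans (distribˡ x _ _) (+-congˡ (*-distribˡ-sum< n x _))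

    *-distribʳ-sum< : ∀ n x h → sum< n h * x ≈ sum< n (λ i → h i * x)
    *-distribʳ-sum< zero    x h = zeroˡ x
    *-distribʳ-sum< (suc n) x h = trans (distribʳ x _ _) (+-congˡ (*-distribʳ-sum< n x _))

  sum<-*-sum< : ∀ m n h g → sum< m h * sum< n g ≈ sum< m (λ i → sum< n (λ j → h i * g j))
  sum<-*-sum< m n h g =
    trans (*-distribʳ-sum< m (sum< n g) h) (sum<-cong m (λ i → *-distribˡ-sum< n (h i) g))

module FormalPowerSeries {c ℓ} (S : CommutativeSemiring c ℓ) where
  open CommutativeSemiring S
  open SemiringSums semiring
  open RawSemiringDefinitions rawSemiring using (_×_)
  open SemiringMult semiring using (×-homo-+; ×1-homo-*)
  open import Algebra.Properties.CommutativeSemigroup *-commutativeSemigroup using () renaming (interchange to *-interchange)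
  open SetoidReasoning setoid

  Series : Set c
  Series = ℕ → Carrier

  infix  4 _≋_
  infixl 6 _+ₛ_
  infixl 7 _*ₛ_ _•_

  _≋_ : Series → Series → Set ℓ
  u ≋ v = ∀ n → u n ≈ v n

  0ₛ 1ₛ xₛ : Series
  0ₛ n = 0#
  1ₛ zero    = 1#
  1ₛ (suc n) = 0#
  xₛ zero          = 0#
  xₛ (suc zero)    = 1#
  xₛ (suc (suc n)) = 0#

  _+ₛ_ _*ₛ_ : Series → Series → Series
  (u +ₛ v) n = u n + v n
  (u *ₛ v) n = sum< (suc n) (λ j → u j * v (n ∸ j))

  _•_ : Carrier → Series → Series
  (a • u) n = a * u n

  *ₛ-cong≤ : ∀ n {u u′ v v′} → (∀ j → j ≤ n → u j ≈ u′ j) → (∀ j → j ≤ n → v j ≈ v′ j) →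
             (u *ₛ v) n ≈ (u′ *ₛ v′) n
  *ₛ-cong≤ n u≈u′ v≈v′ =
    sum<-cong< (suc n) (λ j j≤n → *-cong (u≈u′ j (ℕₚ.≤-pred j≤n)) (v≈v′ (n ∸ j) (ℕₚ.m∸n≤m n j)))

  *ₛ-cong : ∀ {u u′ v v′} → u ≋ u′ → v ≋ v′ → u *ₛ v ≋ u′ *ₛ v′
  *ₛ-cong u≈u′ v≈v′ n = *ₛ-cong≤ n (λ j _ → u≈u′ j) (λ j _ → v≈v′ j)

  *ₛ-comm : ∀ u v → u *ₛ v ≋ v *ₛ u
  *ₛ-comm u v n = begin
    sum< (suc n) (λ j → u j * v (n ∸ j))               ≈⟨ sum<-reverse (suc n) (λ j → u j * v (n ∸ j)) ⟩
    sum< (suc n) (λ j → u (n ∸ j) * v (n ∸ (n ∸ j)))   ≈⟨ sum<-cong< (suc n) commuted ⟩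
    sum< (suc n) (λ j → v j * u (n ∸ j))               ∎
    where
    commuted : ∀ j → j < suc n → u (n ∸ j) * v (n ∸ (n ∸ j)) ≈ v j * u (n ∸ j)
    commuted j j≤n = trans (*-comm _ _) (*-congʳ (reflexive (≡.cong v (ℕₚ.m∸[m∸n]≡n (ℕₚ.≤-pred j≤n)))))

  *ₛ-identityˡ : ∀ u → 1ₛ *ₛ u ≋ u
  *ₛ-identityˡ u n = begin
    (1ₛ *ₛ u) n                                  ≈⟨ sum<-suc n _ ⟩
    1# * u n + sum< n (λ j → 0# * u (n ∸ suc j)) ≈⟨ +-cong (*-identityˡ (u n)) (sum<-zero n (λ j _ → zeroˡ _)) ⟩
    u n + 0#                                     ≈⟨ +-identityʳ (u n) ⟩
    u n                                          ∎

  *ₛ-zeroˡ : ∀ u → 0ₛ *ₛ u ≋ 0ₛ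
  *ₛ-zeroˡ u n = sum<-zero (suc n) (λ j _ → zeroˡ _)

  *ₛ-distribʳ : ∀ u v w → (v +ₛ w) *ₛ u ≋ v *ₛ u +ₛ w *ₛ u
  *ₛ-distribʳ u v w n =
    trans (sum<-cong (suc n) (λ j → distribʳ (u (n ∸ j)) (v j) (w j))) (sum<-distrib (suc n) _ _)

  *ₛ-assoc : ∀ u v w → (u *ₛ v) *ₛ w ≋ u *ₛ (v *ₛ w)
  *ₛ-assoc u v w n = begin
    sum< (suc n) (λ s → (u *ₛ v) s * w (n ∸ s))                ≈⟨ sum<-cong (suc n) distributed ⟩
    sum< (suc n) (λ s → sum< (suc s) (λ i → H i (s ∸ i)))      ≈⟨ sum<-triangle n H ⟩
    sum< (suc n) (λ i → sum< (suc (n ∸ i)) (H i))              ≈⟨ sum<-cong (suc n) factored ⟩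
    sum< (suc n) (λ i → u i * (v *ₛ w) (n ∸ i))                ∎
    where
    H : ℕ → ℕ → Carrier
    H i j = u i * v j * w (n ∸ (i ℕ.+ j))
    distributed : ∀ s → (u *ₛ v) s * w (n ∸ s) ≈ sum< (suc s) (λ i → H i (s ∸ i))
    distributed s = trans (*-distribʳ-sum< (suc s) (w (n ∸ s)) (λ i → u i * v (s ∸ i)))
      (sum<-cong< (suc s) (λ i i≤s →
        *-congˡ (reflexive (≡.cong (λ t → w (n ∸ t)) (≡.sym (ℕₚ.m+[n∸m]≡n (ℕₚ.≤-pred i≤s)))))))
    factored : ∀ i → sum< (suc (n ∸ i)) (H i) ≈ u i * (v *ₛ w) (n ∸ i)
    factored i = sym (trans (*-distribˡ-sum< (suc (n ∸ i)) (u i) (λ j → v j * w (n ∸ i ∸ j)))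
      (sum<-cong (suc (n ∸ i)) (λ j → trans (sym (*-assoc _ _ _))
        (*-congˡ (reflexive (≡.cong w (ℕₚ.∸-+-assoc n i j)))))))

  seriesCommutativeSemiring : CommutativeSemiring c ℓ
  seriesCommutativeSemiring = record
    { _≈_                   = _≋_
    ; _+_                   = _+ₛ_
    ; _*_                   = _*ₛ_
    ; 0#                    = 0ₛ
    ; 1#                    = 1ₛ
    ; isCommutativeSemiring = isCommutativeSemiringˡ record
      { +-isCommutativeMonoid = Pointwise.isCommutativeMonoid +-isCommutativeMonoid
      ; *-isCommutativeMonoid = isCommutativeMonoidˡ record
        { isSemigroup = record
          { isMagma = record { isEquivalence = Pointwise.isEquivalence isEquivalence ; ∙-cong = *ₛ-cong }
          ; assoc   = *ₛ-assoc
          }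
        ; identityˡ = *ₛ-identityˡ
        ; comm      = *ₛ-comm
        }
      ; distribʳ = *ₛ-distribʳ
      ; zeroˡ    = *ₛ-zeroˡ
      }
    }
    where open Biased _≋_ using (isCommutativeSemiringˡ; isCommutativeMonoidˡ)

  module Series = CommutativeSemiring seriesCommutativeSemiring
  open RawSemiringDefinitions Series.rawSemiring public using () renaming (_^_ to _^ₛ_)
  open SemiringExp Series.semiring public using () renaming (^-homo-* to ^ₛ-homo-*ₛ; ^-congˡ to ^ₛ-congˡ)

  *ₛ-coeff₀ : ∀ u v → (u *ₛ v) 0 ≈ u 0 * v 0
  *ₛ-coeff₀ u v = trans (sum<-suc 0 _) (trans (+-congˡ (sum<-empty _)) (+-identityʳ _))

  *ₛ-cong-below : ∀ n {h y z} → h 0 ≈ 0# → (∀ m → m < n → y m ≈ z m) → (h *ₛ y) n ≈ (h *ₛ z) n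
  *ₛ-cong-below n {h} {y} {z} h₀≈0 y≈z = begin
    (h *ₛ y) n                                           ≈⟨ sum<-suc n _ ⟩
    h 0 * y n + sum< n (λ j → h (suc j) * y (n ∸ suc j))  ≈⟨ +-cong (*-congʳ h₀≈0) (sum<-cong< n agree) ⟩
    0# * y n + sum< n (λ j → h (suc j) * z (n ∸ suc j))   ≈⟨ +-congʳ (trans (zeroˡ _) (sym (zeroˡ _))) ⟩
    0# * z n + sum< n (λ j → h (suc j) * z (n ∸ suc j))   ≈⟨ +-congʳ (*-congʳ h₀≈0) ⟨
    h 0 * z n + sum< n (λ j → h (suc j) * z (n ∸ suc j))  ≈⟨ sum<-suc n _ ⟨
    (h *ₛ z) n                                           ∎
    where
    agree : ∀ j → j < n → h (suc j) * y (n ∸ suc j) ≈ h (suc j) * z (n ∸ suc j)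
    agree j j<n = *-congˡ (y≈z (n ∸ suc j) (ℕₚ.∸-monoʳ-< z<s j<n))

  •-*ₛ : ∀ a u v → a • u *ₛ v ≋ a • (u *ₛ v)
  •-*ₛ a u v n = trans (sum<-cong (suc n) (λ j → *-assoc a (u j) (v (n ∸ j))))
                       (sym (*-distribˡ-sum< (suc n) a (λ j → u j * v (n ∸ j))))

  xₛ-*ₛ-coeff₀ : ∀ u → (xₛ *ₛ u) 0 ≈ 0#
  xₛ-*ₛ-coeff₀ u = trans (*ₛ-coeff₀ xₛ u) (zeroˡ (u 0))

  xₛ-*ₛ-coeffₛ : ∀ u n → (xₛ *ₛ u) (suc n) ≈ u n
  xₛ-*ₛ-coeffₛ u n = begin
    (xₛ *ₛ u) (suc n)
      ≈⟨ sum<-suc (suc n) _ ⟩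
    0# * u (suc n) + sum< (suc n) (λ j → xₛ (suc j) * u (n ∸ j))
      ≈⟨ +-cong (zeroˡ _) (sum<-suc n _) ⟩
    0# + (1# * u n + sum< n (λ j → 0# * u (n ∸ suc j)))
      ≈⟨ +-identityˡ _ ⟩
    1# * u n + sum< n (λ j → 0# * u (n ∸ suc j))
      ≈⟨ +-cong (*-identityˡ (u n)) (sum<-zero n (λ j _ → zeroˡ _)) ⟩
    u n + 0#
      ≈⟨ +-identityʳ (u n) ⟩
    u n
      ∎

  ^ₛ-order : ∀ {u} → u 0 ≈ 0# → ∀ k n → n < k → (u ^ₛ k) n ≈ 0#
  ^ₛ-order {u} u₀≈0 (suc k) n n<1+k = begin
    (u *ₛ u ^ₛ k) n
      ≈⟨ sum<-suc n _ ⟩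
    u 0 * (u ^ₛ k) n + sum< n (λ j → u (suc j) * (u ^ₛ k) (n ∸ suc j))
      ≈⟨ +-cong (trans (*-congʳ u₀≈0) (zeroˡ _)) (sum<-zero n vanishing) ⟩
    0# + 0#
      ≈⟨ +-identityʳ 0# ⟩
    0#
      ∎
    where
    vanishing : ∀ j → j < n → u (suc j) * (u ^ₛ k) (n ∸ suc j) ≈ 0#
    vanishing j j<n =
      trans (*-congˡ (^ₛ-order u₀≈0 k (n ∸ suc j) n∸[1+j]<k)) (zeroʳ _)
      where
      n∸[1+j]<k : n ∸ suc j < k
      n∸[1+j]<k = ℕₚ.<-≤-trans (ℕₚ.∸-monoʳ-< z<s j<n) (ℕₚ.≤-pred n<1+k)

  IsInvertOf : Series → Series → Set ℓ
  IsInvertOf y h = y ≋ 1ₛ +ₛ h *ₛ y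

  IsInvertOf-unique : ∀ {h y z} → h 0 ≈ 0# → IsInvertOf y h → IsInvertOf z h → y ≋ z
  IsInvertOf-unique {h} {y} {z} h₀≈0 y≈1+hy z≈1+hz = <-rec (λ n → y n ≈ z n) step
    where
    step : ∀ n → (∀ {m} → m < n → y m ≈ z m) → y n ≈ z n
    step n y≈z = begin
      y n                ≈⟨ y≈1+hy n ⟩
      1ₛ n + (h *ₛ y) n  ≈⟨ +-congˡ (*ₛ-cong-below n h₀≈0 (λ m → y≈z)) ⟩
      1ₛ n + (h *ₛ z) n  ≈⟨ z≈1+hz n ⟨
      z n                ∎

  IsInvertOf-congʳ : ∀ {h h′ y} → h ≋ h′ → IsInvertOf y h → IsInvertOf y h′
  IsInvertOf-congʳ {y = y} h≈h′ y≈1+hy n = trans (y≈1+hy n) (+-congˡ (*ₛ-cong {v = y} h≈h′ (λ _ → refl) n))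

  -- x / (1 - r x)
  geometric : ℕ → Series
  geometric r zero    = 0#
  geometric r (suc i) = (r ℕ.^ i) × 1#

  geometric-rec : ∀ r → geometric r ≋ xₛ +ₛ (r × 1#) • (xₛ *ₛ geometric r)
  geometric-rec r zero          =
    sym (trans (+-congˡ (trans (*-congˡ (xₛ-*ₛ-coeff₀ (geometric r))) (zeroʳ _))) (+-identityʳ 0#))
  geometric-rec r (suc zero)    = +-congˡ (sym (trans (*-congˡ (xₛ-*ₛ-coeffₛ (geometric r) 0)) (zeroʳ _)))
  geometric-rec r (suc (suc i)) = begin
    (r ℕ.* r ℕ.^ i) × 1#                              ≈⟨ ×1-homo-* r (r ℕ.^ i) ⟩
    (r × 1#) * geometric r (suc i)                    ≈⟨ *-congˡ (xₛ-*ₛ-coeffₛ (geometric r) (suc i)) ⟨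
    (r × 1#) * (xₛ *ₛ geometric r) (suc (suc i))      ≈⟨ +-identityˡ _ ⟨
    0# + (r × 1#) * (xₛ *ₛ geometric r) (suc (suc i)) ∎

  geometric-*ₛ : ∀ r u → geometric r *ₛ u ≋ xₛ *ₛ u +ₛ (r × 1#) • (xₛ *ₛ (geometric r *ₛ u))
  geometric-*ₛ r u =
    Series.trans (Series.*-congʳ {u} (geometric-rec r))
      (Series.trans (Series.distribʳ u xₛ ((r × 1#) • (xₛ *ₛ geometric r)))
        (Series.+-congˡ (Series.trans (•-*ₛ (r × 1#) (xₛ *ₛ geometric r) u)
          (λ n → *-congˡ (Series.*-assoc xₛ (geometric r) u n)))))

  geometric-*ₛ-coeffₛ : ∀ r u i → (geometric r *ₛ u) (suc i) ≈ u i + (r × 1#) * (geometric r *ₛ u) i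
  geometric-*ₛ-coeffₛ r u i =
    trans (geometric-*ₛ r u (suc i)) (+-cong (xₛ-*ₛ-coeffₛ u i) (*-congˡ (xₛ-*ₛ-coeffₛ (geometric r *ₛ u) i)))

  geometric-^ₛ-coeff : ∀ r k i → (geometric r ^ₛ k) i ≈ geometricPowerCoeff r k i × 1#
  geometric-^ₛ-coeff r zero    zero    = sym (+-identityʳ 1#)
  geometric-^ₛ-coeff r zero    (suc i) = refl
  geometric-^ₛ-coeff r (suc k) zero    = trans (*ₛ-coeff₀ (geometric r) (geometric r ^ₛ k)) (zeroˡ _)
  geometric-^ₛ-coeff r (suc k) (suc i) = begin
    (geometric r *ₛ geometric r ^ₛ k) (suc i)
      ≈⟨ geometric-*ₛ-coeffₛ r (geometric r ^ₛ k) i ⟩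
    (geometric r ^ₛ k) i + (r × 1#) * (geometric r ^ₛ suc k) i
      ≈⟨ +-cong (geometric-^ₛ-coeff r k i) (*-congˡ (geometric-^ₛ-coeff r (suc k) i)) ⟩
    geometricPowerCoeff r k i × 1# + (r × 1#) * (geometricPowerCoeff r (suc k) i × 1#)
      ≈⟨ +-congˡ (×1-homo-* r (geometricPowerCoeff r (suc k) i)) ⟨
    geometricPowerCoeff r k i × 1# + (r ℕ.* geometricPowerCoeff r (suc k) i) × 1#
      ≈⟨ ×-homo-+ 1# (geometricPowerCoeff r k i) (r ℕ.* geometricPowerCoeff r (suc k) i) ⟨
    (geometricPowerCoeff r k i ℕ.+ r ℕ.* geometricPowerCoeff r (suc k) i) × 1#
      ≡⟨ ≡.cong (_× 1#) (geometricPowerCoeff-pascal r k i) ⟨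
    geometricPowerCoeff r (suc k) (suc i) × 1#
      ∎

  geometric-*ₛ-1+geometric : ∀ r → geometric r *ₛ (1ₛ +ₛ geometric (suc r)) ≋ geometric (suc r)
  geometric-*ₛ-1+geometric r zero          = trans (*ₛ-coeff₀ (geometric r) (1ₛ +ₛ geometric (suc r))) (zeroˡ _)
  geometric-*ₛ-1+geometric r (suc zero)    = begin
    (geometric r *ₛ (1ₛ +ₛ geometric (suc r))) 1
      ≈⟨ geometric-*ₛ-coeffₛ r (1ₛ +ₛ geometric (suc r)) 0 ⟩
    (1# + 0#) + (r × 1#) * (geometric r *ₛ (1ₛ +ₛ geometric (suc r))) 0
      ≈⟨ +-congˡ (trans (*-congˡ (geometric-*ₛ-1+geometric r 0)) (zeroʳ _)) ⟩
    (1# + 0#) + 0#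
      ≈⟨ +-identityʳ _ ⟩
    1# + 0#
      ∎
  geometric-*ₛ-1+geometric r (suc (suc i)) = begin
    (geometric r *ₛ (1ₛ +ₛ geometric (suc r))) (suc (suc i))
      ≈⟨ geometric-*ₛ-coeffₛ r (1ₛ +ₛ geometric (suc r)) (suc i) ⟩
    (0# + x × 1#) + (r × 1#) * (geometric r *ₛ (1ₛ +ₛ geometric (suc r))) (suc i)
      ≈⟨ +-cong (+-identityˡ _) (*-congˡ (geometric-*ₛ-1+geometric r (suc i))) ⟩
    x × 1# + (r × 1#) * (x × 1#)
      ≈⟨ +-congˡ (×1-homo-* r x) ⟨
    x × 1# + (r ℕ.* x) × 1#
      ≈⟨ ×-homo-+ 1# x (r ℕ.* x) ⟨
    (x ℕ.+ r ℕ.* x) × 1#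
      ∎
    where
    x : ℕ
    x = suc r ℕ.^ i

  geometric-IsInvertOf : ∀ r → IsInvertOf (1ₛ +ₛ geometric (suc r)) (geometric r)
  geometric-IsInvertOf r n = +-congˡ (sym (geometric-*ₛ-1+geometric r n))

  infixr 9 _∘ₛ_

  -- Substitution p(f): summing only i ≤ n is exact when f 0 ≈ 0#, the only case used.
  _∘ₛ_ : Series → Series → Series
  (p ∘ₛ f) n = sum< (suc n) (λ i → p i * (f ^ₛ i) n)

  ∘ₛ-coeff₀ : ∀ p f → (p ∘ₛ f) 0 ≈ p 0
  ∘ₛ-coeff₀ p f =
    trans (sum<-suc 0 _) (trans (+-congˡ (sum<-empty _)) (trans (+-identityʳ _) (*-identityʳ (p 0))))

  ∘ₛ-congˡ : ∀ {p q} f → p ≋ q → p ∘ₛ f ≋ q ∘ₛ f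
  ∘ₛ-congˡ f p≈q n = sum<-cong (suc n) (λ i → *-congʳ (p≈q i))

  ∘ₛ-homo-+ : ∀ p q f → (p +ₛ q) ∘ₛ f ≋ p ∘ₛ f +ₛ q ∘ₛ f
  ∘ₛ-homo-+ p q f n =
    trans (sum<-cong (suc n) (λ i → distribʳ ((f ^ₛ i) n) (p i) (q i))) (sum<-distrib (suc n) _ _)

  ∘ₛ-homo-1 : ∀ f → 1ₛ ∘ₛ f ≋ 1ₛ
  ∘ₛ-homo-1 f n = begin
    (1ₛ ∘ₛ f) n                                       ≈⟨ sum<-suc n _ ⟩
    1# * 1ₛ n + sum< n (λ i → 0# * (f ^ₛ suc i) n)    ≈⟨ +-cong (*-identityˡ _) (sum<-zero n (λ i _ → zeroˡ _)) ⟩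
    1ₛ n + 0#                                         ≈⟨ +-identityʳ _ ⟩
    1ₛ n                                              ∎

  module Substitution {f : Series} (f₀≈0 : f 0 ≈ 0#) where

    xₛ-∘ₛ : xₛ ∘ₛ f ≋ f
    xₛ-∘ₛ zero    = trans (∘ₛ-coeff₀ xₛ f) (sym f₀≈0)
    xₛ-∘ₛ (suc n) = begin
      (xₛ ∘ₛ f) (suc n)
        ≈⟨ sum<-suc (suc n) _ ⟩
      0# * 1ₛ (suc n) + sum< (suc n) (λ i → xₛ (suc i) * (f ^ₛ suc i) (suc n))
        ≈⟨ +-cong (zeroˡ _) (sum<-suc n _) ⟩
      0# + (1# * (f ^ₛ 1) (suc n) + sum< n (λ i → 0# * (f ^ₛ suc (suc i)) (suc n)))
        ≈⟨ +-identityˡ _ ⟩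
      1# * (f ^ₛ 1) (suc n) + sum< n (λ i → 0# * (f ^ₛ suc (suc i)) (suc n))
        ≈⟨ +-cong (*-identityˡ _) (sum<-zero n (λ i _ → zeroˡ _)) ⟩
      (f ^ₛ 1) (suc n) + 0#
        ≈⟨ +-identityʳ _ ⟩
      (f ^ₛ 1) (suc n)
        ≈⟨ Series.*-identityʳ f (suc n) ⟩
      f (suc n)
        ∎

    ∘ₛ-extend : ∀ p n N → suc n ≤ N → (p ∘ₛ f) n ≈ sum< N (λ i → p i * (f ^ₛ i) n)
    ∘ₛ-extend p n N n<N = sum<-extend (suc n) N _ n<N
      (λ i n<i _ → trans (*-congˡ (^ₛ-order f₀≈0 i n n<i)) (zeroʳ _))

    doubleSum : Series → Series → ℕ → Carrier
    doubleSum p q n = sum< (suc n) (λ a → sum< (suc n) (λ b → (p a * q b) * (f ^ₛ (a ℕ.+ b)) n))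

    *ₛ-∘ₛ-doubleSum : ∀ p q n → ((p *ₛ q) ∘ₛ f) n ≈ doubleSum p q n
    *ₛ-∘ₛ-doubleSum p q n = begin
      sum< (suc n) (λ i → (p *ₛ q) i * (f ^ₛ i) n)             ≈⟨ sum<-cong (suc n) distributed ⟩
      sum< (suc n) (λ i → sum< (suc i) (λ a → G a (i ∸ a)))    ≈⟨ sum<-triangle n G ⟩
      sum< (suc n) (λ a → sum< (suc (n ∸ a)) (G a))            ≈⟨ sum<-cong (suc n) extended ⟩
      doubleSum p q n                                         ∎
      where
      G : ℕ → ℕ → Carrier
      G a b = (p a * q b) * (f ^ₛ (a ℕ.+ b)) n
      distributed : ∀ i → (p *ₛ q) i * (f ^ₛ i) n ≈ sum< (suc i) (λ a → G a (i ∸ a))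
      distributed i = trans (*-distribʳ-sum< (suc i) ((f ^ₛ i) n) (λ a → p a * q (i ∸ a)))
        (sum<-cong< (suc i) (λ a a≤i →
          *-congˡ (reflexive (≡.cong (λ t → (f ^ₛ t) n) (≡.sym (ℕₚ.m+[n∸m]≡n (ℕₚ.≤-pred a≤i)))))))
      extended : ∀ a → sum< (suc (n ∸ a)) (G a) ≈ sum< (suc n) (G a)
      extended a = sum<-extend (suc (n ∸ a)) (suc n) (G a) (s≤s (ℕₚ.m∸n≤m n a))
        (λ b n∸a<b _ → trans (*-congˡ (^ₛ-order f₀≈0 (a ℕ.+ b) n
          (ℕₚ.≤-<-trans (ℕₚ.m≤n+m∸n n a) (ℕₚ.+-monoʳ-< a n∸a<b)))) (zeroʳ _))

    ∘ₛ-*ₛ-doubleSum : ∀ p q n → ((p ∘ₛ f) *ₛ (q ∘ₛ f)) n ≈ doubleSum p q n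
    ∘ₛ-*ₛ-doubleSum p q n = begin
      ((p ∘ₛ f) *ₛ (q ∘ₛ f)) n
        ≈⟨ *ₛ-cong≤ n (λ j j≤n → ∘ₛ-extend p j N (s≤s j≤n)) (λ j j≤n → ∘ₛ-extend q j N (s≤s j≤n)) ⟩
      sum< N (λ j → sum< N (λ a → p a * (f ^ₛ a) j) * sum< N (λ b → q b * (f ^ₛ b) (n ∸ j)))
        ≈⟨ sum<-cong N (λ j → sum<-*-sum< N N (λ a → p a * (f ^ₛ a) j) (λ b → q b * (f ^ₛ b) (n ∸ j))) ⟩
      sum< N (λ j → sum< N (λ a → sum< N (λ b → K a b j)))
        ≈⟨ sum<-comm N N (λ j a → sum< N (λ b → K a b j)) ⟩
      sum< N (λ a → sum< N (λ j → sum< N (λ b → K a b j)))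
        ≈⟨ sum<-cong N (λ a → sum<-comm N N (λ j b → K a b j)) ⟩
      sum< N (λ a → sum< N (λ b → sum< N (K a b)))
        ≈⟨ sum<-cong N (λ a → sum<-cong N (collected a)) ⟩
      doubleSum p q n
        ∎
      where
      N : ℕ
      N = suc n
      K : ℕ → ℕ → ℕ → Carrier
      K a b j = (p a * (f ^ₛ a) j) * (q b * (f ^ₛ b) (n ∸ j))
      collected : ∀ a b → sum< N (K a b) ≈ (p a * q b) * (f ^ₛ (a ℕ.+ b)) n
      collected a b = begin
        sum< N (K a b)                                                  ≈⟨ sum<-cong N (λ j → *-interchange _ _ _ _) ⟩
        sum< N (λ j → (p a * q b) * ((f ^ₛ a) j * (f ^ₛ b) (n ∸ j)))   ≈⟨ *-distribˡ-sum< N (p a * q b) _ ⟨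
        (p a * q b) * (f ^ₛ a *ₛ f ^ₛ b) n                             ≈⟨ *-congˡ (^ₛ-homo-*ₛ f a b n) ⟨
        (p a * q b) * (f ^ₛ (a ℕ.+ b)) n                               ∎

    ∘ₛ-homo-* : ∀ p q → (p *ₛ q) ∘ₛ f ≋ (p ∘ₛ f) *ₛ (q ∘ₛ f)
    ∘ₛ-homo-* p q n = trans (*ₛ-∘ₛ-doubleSum p q n) (sym (∘ₛ-*ₛ-doubleSum p q n))

    ∘ₛ-homo-^ : ∀ p k → (p ^ₛ k) ∘ₛ f ≋ (p ∘ₛ f) ^ₛ k
    ∘ₛ-homo-^ p zero    = ∘ₛ-homo-1 f
    ∘ₛ-homo-^ p (suc k) = Series.trans (∘ₛ-homo-* p (p ^ₛ k)) (Series.*-congˡ (∘ₛ-homo-^ p k))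

    ∘ₛ-IsInvertOf : ∀ {y h} → IsInvertOf y h → IsInvertOf (y ∘ₛ f) (h ∘ₛ f)
    ∘ₛ-IsInvertOf {y} {h} y≈1+hy =
      Series.trans (∘ₛ-congˡ f y≈1+hy)
        (Series.trans (∘ₛ-homo-+ 1ₛ (h *ₛ y) f) (Series.+-cong (∘ₛ-homo-1 f) (∘ₛ-homo-* h y)))

module InvertTransform {c ℓ} (R : CommutativeRing c ℓ) where
  open CommutativeRing R
  open FormalPowerSeries commutativeSemiring
  open SemiringSums semiring
  open RawSemiringDefinitions (Semiring.rawSemiring semiring) using (_×_)
  open SemiringMult semiring using (×-assoc-*; ×-congʳ)
  open SetoidReasoning setoid

  -- Σ_{n ≥ 1} g n xⁿ; cc, invert and f never use the value g 0
  gf : (ℕ → Carrier) → Series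
  gf g zero    = 0#
  gf g (suc n) = g (suc n)

  sumFrom≈sum< : ∀ lo l h → sumFrom R lo l h ≈ sum< l (λ j → h (lo ℕ.+ j))
  sumFrom≈sum< lo zero    h = sym (sum<-empty _)
  sumFrom≈sum< lo (suc l) h = begin
    h lo + sumFrom R (suc lo) l h
      ≈⟨ +-congˡ (sumFrom≈sum< (suc lo) l h) ⟩
    h lo + sum< l (λ j → h (suc lo ℕ.+ j))
      ≈⟨ +-cong (reflexive (≡.cong h (ℕₚ.+-identityʳ lo)))
                (sum<-cong l (λ j → reflexive (≡.cong h (ℕₚ.+-suc lo j)))) ⟨
    h (lo ℕ.+ 0) + sum< l (λ j → h (lo ℕ.+ suc j))
      ≈⟨ sum<-suc l _ ⟨
    sum< (suc l) (λ j → h (lo ℕ.+ j))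
      ∎

  cc-suc : ∀ g n k → cc R g n (suc k) ≡ sumFrom R 1 (n ∸ k) (λ i → g i * cc R g (n ∸ i) k)
  cc-suc g zero    k = ≡.refl
  cc-suc g (suc n) k = ≡.refl

  cc-below : ∀ g n k → n < k → cc R g n k ≈ 0#
  cc-below g n (suc k) (s≤s n≤k) rewrite cc-suc g n k | ℕₚ.m≤n⇒m∸n≡0 n≤k = refl

  cc-rec : ∀ g k → (λ n → cc R g n (suc k)) ≋ gf g *ₛ (λ n → cc R g n k)
  cc-rec g k n = begin
    cc R g n (suc k)                                                  ≡⟨ cc-suc g n k ⟩
    sumFrom R 1 (n ∸ k) (λ i → g i * cc R g (n ∸ i) k)                ≈⟨ sumFrom≈sum< 1 (n ∸ k) _ ⟩
    sum< (n ∸ k) (λ j → g (suc j) * cc R g (n ∸ suc j) k)             ≈⟨ sum<-extend (n ∸ k) n _ (ℕₚ.m∸n≤m n k) vanishing ⟩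
    sum< n (λ j → g (suc j) * cc R g (n ∸ suc j) k)                   ≈⟨ +-identityˡ _ ⟨
    0# + sum< n (λ j → g (suc j) * cc R g (n ∸ suc j) k)              ≈⟨ +-congʳ (zeroˡ _) ⟨
    0# * cc R g n k + sum< n (λ j → g (suc j) * cc R g (n ∸ suc j) k) ≈⟨ sum<-suc n _ ⟨
    (gf g *ₛ (λ m → cc R g m k)) n                                    ∎
    where
    vanishing : ∀ j → n ∸ k ≤ j → j < n → g (suc j) * cc R g (n ∸ suc j) k ≈ 0#
    vanishing j n∸k≤j j<n =
      trans (*-congˡ (cc-below g (n ∸ suc j) k (n∸k≤j⇒n∸[1+j]<k n k j n∸k≤j j<n))) (zeroʳ _)

  cc≈gf^ : ∀ g k → (λ n → cc R g n k) ≋ gf g ^ₛ k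
  cc≈gf^ g zero    zero    = refl
  cc≈gf^ g zero    (suc n) = refl
  cc≈gf^ g (suc k)         = Series.trans (cc-rec g k) (Series.*-congˡ (cc≈gf^ g k))

  conv-table : ∀ h i n → conv R h i (table R h n) ≈ sum< (suc n) (λ j → h (i ℕ.+ j) * invert R h (n ∸ j))
  conv-table h i zero    = begin
    h i * 1# + 0#
      ≈⟨ +-cong (*-congʳ (reflexive (≡.cong h (ℕₚ.+-identityʳ i)))) (sum<-empty _) ⟨
    h (i ℕ.+ 0) * 1# + sum< 0 _
      ≈⟨ sum<-suc 0 _ ⟨
    sum< 1 (λ j → h (i ℕ.+ j) * invert R h (0 ∸ j))
      ∎
  conv-table h i (suc n) = begin
    h i * invert R h (suc n) + conv R h (suc i) (table R h n)
      ≈⟨ +-cong (*-congʳ (reflexive (≡.cong h (≡.sym (ℕₚ.+-identityʳ i))))) (conv-table h (suc i) n) ⟩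
    h (i ℕ.+ 0) * invert R h (suc n) + sum< (suc n) (λ j → h (suc i ℕ.+ j) * invert R h (n ∸ j))
      ≈⟨ +-congˡ (sum<-cong (suc n) (λ j → *-congʳ (reflexive (≡.cong h (ℕₚ.+-suc i j))))) ⟨
    h (i ℕ.+ 0) * invert R h (suc n) + sum< (suc n) (λ j → h (i ℕ.+ suc j) * invert R h (n ∸ j))
      ≈⟨ sum<-suc (suc n) _ ⟨
    sum< (suc (suc n)) (λ j → h (i ℕ.+ j) * invert R h (suc n ∸ j))
      ∎

  invert-IsInvertOf : ∀ g → IsInvertOf (invert R g) (gf g)
  invert-IsInvertOf g zero    =
    sym (trans (+-congˡ (trans (*ₛ-coeff₀ (gf g) (invert R g)) (zeroˡ _))) (+-identityʳ 1#))
  invert-IsInvertOf g (suc n) = begin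
    conv R g 1 (table R g n)                                                      ≈⟨ conv-table g 1 n ⟩
    sum< (suc n) (λ j → g (suc j) * invert R g (n ∸ j))                           ≈⟨ +-identityˡ _ ⟨
    0# + sum< (suc n) (λ j → g (suc j) * invert R g (n ∸ j))                      ≈⟨ +-congʳ (zeroˡ _) ⟨
    0# * invert R g (suc n) + sum< (suc n) (λ j → g (suc j) * invert R g (n ∸ j)) ≈⟨ sum<-suc (suc n) _ ⟨
    (gf g *ₛ invert R g) (suc n)                                                  ≈⟨ +-identityˡ _ ⟨
    0# + (gf g *ₛ invert R g) (suc n)                                             ∎

  geometric-0≋xₛ : geometric 0 ≋ xₛ
  geometric-0≋xₛ zero          = refl
  geometric-0≋xₛ (suc zero)    = +-identityʳ 1#
  geometric-0≋xₛ (suc (suc i)) = refl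

  module _ (f₀ : ℕ → Carrier) where
    open Substitution {gf f₀} refl

    gf-f : ∀ m → gf (f R f₀ m) ≋ geometric m ∘ₛ gf f₀
    gf-f zero            = Series.sym (Series.trans (∘ₛ-congˡ (gf f₀) geometric-0≋xₛ) xₛ-∘ₛ)
    gf-f (suc m) zero    = sym (∘ₛ-coeff₀ (geometric (suc m)) (gf f₀))
    gf-f (suc m) (suc n) = begin
      invert R (f R f₀ m) (suc n)                                   ≈⟨ invert-f (suc n) ⟩
      ((1ₛ +ₛ geometric (suc m)) ∘ₛ gf f₀) (suc n)                  ≈⟨ ∘ₛ-homo-+ 1ₛ (geometric (suc m)) (gf f₀) (suc n) ⟩
      (1ₛ ∘ₛ gf f₀) (suc n) + (geometric (suc m) ∘ₛ gf f₀) (suc n)  ≈⟨ +-congʳ (∘ₛ-homo-1 (gf f₀) (suc n)) ⟩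
      0# + (geometric (suc m) ∘ₛ gf f₀) (suc n)                     ≈⟨ +-identityˡ _ ⟩
      (geometric (suc m) ∘ₛ gf f₀) (suc n)                          ∎
      where
      invert-f : invert R (f R f₀ m) ≋ (1ₛ +ₛ geometric (suc m)) ∘ₛ gf f₀
      invert-f = IsInvertOf-unique refl (invert-IsInvertOf (f R f₀ m))
        (IsInvertOf-congʳ (Series.sym (gf-f m)) (∘ₛ-IsInvertOf (geometric-IsInvertOf m)))

    cm-expansion : ∀ m n k → cm R f₀ (suc m) n k ≈ sum< (suc n) (λ i → (geometric m ^ₛ k) i * cm R f₀ 1 n i)
    cm-expansion m n k = begin
      cc R (f R f₀ m) n k                                          ≈⟨ cc≈gf^ (f R f₀ m) k n ⟩
      (gf (f R f₀ m) ^ₛ k) n                                       ≈⟨ ^ₛ-congˡ k (gf-f m) n ⟩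
      ((geometric m ∘ₛ gf f₀) ^ₛ k) n                              ≈⟨ ∘ₛ-homo-^ (geometric m) k n ⟨
      sum< (suc n) (λ i → (geometric m ^ₛ k) i * (gf f₀ ^ₛ i) n)   ≈⟨ sum<-cong (suc n) (λ i → *-congˡ (cc≈gf^ f₀ i n)) ⟨
      sum< (suc n) (λ i → (geometric m ^ₛ k) i * cc R f₀ n i)      ∎

    cm≈rhs : ∀ m n k → suc k ≤ n → cm R f₀ (suc m) n (suc k) ≈ rhs R f₀ (suc m) n (suc k)
    cm≈rhs m n k k<n = begin
      cm R f₀ (suc m) n (suc k)
        ≈⟨ cm-expansion m n (suc k) ⟩
      sum< (suc n) (λ i → (geometric m ^ₛ suc k) i * cm R f₀ 1 n i)
        ≈⟨ sum<-dropPrefix (suc k) (suc n) _ (ℕₚ.m≤n⇒m≤1+n k<n) belowOrder ⟩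
      sum< (n ∸ k) (λ j → (geometric m ^ₛ suc k) (suc k ℕ.+ j) * cm R f₀ 1 n (suc k ℕ.+ j))
        ≈⟨ sum<-cong (n ∸ k) (λ j → coefficient (k ℕ.+ j)) ⟩
      sum< (n ∸ k) (λ j → term (suc k ℕ.+ j))
        ≈⟨ sumFrom≈sum< (suc k) (n ∸ k) term ⟨
      rhs R f₀ (suc m) n (suc k)
        ∎
      where
      term : ℕ → Carrier
      term i = (m ℕ.^ (i ∸ suc k) ℕ.* ((i ∸ 1) C k)) × cm R f₀ 1 n i
      belowOrder : ∀ i → i < suc k → (geometric m ^ₛ suc k) i * cm R f₀ 1 n i ≈ 0#
      belowOrder i i<1+k = trans (*-congʳ (^ₛ-order refl (suc k) i i<1+k)) (zeroˡ _)
      coefficient : ∀ i → (geometric m ^ₛ suc k) (suc i) * cm R f₀ 1 n (suc i) ≈ term (suc i)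
      coefficient i = trans (*-congʳ (geometric-^ₛ-coeff m (suc k) (suc i)))
        (trans (×-assoc-* b 1# _) (×-congʳ b (*-identityˡ _)))
        where
        b : ℕ
        b = m ℕ.^ (i ∸ k) ℕ.* (i C k)

proposition9 : ∀ {c ℓ} (R : CommutativeRing c ℓ) (f₀ : ℕ → CommutativeRing.Carrier R)
    (m n k : ℕ) → 1 ≤ m → 1 ≤ k → k ≤ n →
    CommutativeRing._≈_ R (cm R f₀ m n k) (rhs R f₀ m n k)
proposition9 R f₀ (suc m) n (suc k) (s≤s z≤n) (s≤s z≤n) k≤n = InvertTransform.cm≈rhs R f₀ m n k k≤n
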